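{- Let $\mathfrak E$ be an EOS satisfying the standing assumptions below. If $\iota$ and $\tau$ are configurations of $\mathfrak E$ and $\tau$ is $\le_f$-coverable from $\iota$ in $\mathfrak E^{cons}$, then $\tau$ is $(\le_f,\omega)$-coverable from $\iota$ in $\mathfrak E$.
   Context: EOS: A PN is $(P,T,F)$ with $F:(P\times T)\cup(T\times P)\to\mathbb N$, ${\tt pre}_N(t)(p)=F(p,t)$, ${\tt post}_N(t)(p)=F(t,p)$; $\blacksquare=(\emptyset,\emptyset,\emptyset)$ with unique marking $\varepsilon$. An EOS is $(\hat N,\mathcal N,d,\Theta)$: system PN $\hat N=(\hat P,\hat T,\hat F)$ containing idle transitions $id_p$ ($p\in\hat P$) consuming and producing one token on $p$ only; finite set $\mathcal N\ni\blacksquare$ of object PNs, all nets pairwise disjoint; typing $d:\hat P\to\mathcal N$; finite event set $\Theta$ of pairs $(\hat\tau,\theta)$, $\hat\tau\in\hat T$, $\theta(N)$ a finite multiset of transitions of $N$, with $\theta(d(p))\ne\emptyset$ if $\hat\tau=id_p$. Configurations: finite multisets of nested tokens $(\hat p,m)$, $m$ a marking of $d(\hat p)$. With $\Pi^1(\sum_i(\hat p_i,m_i))=\sum_i\hat p_i$, $\Pi^2_N(\sum_i(\hat p_i,m_i))=\sum_{d(\hat p_i)=N}m_i$: event $(\hat\tau,\theta)$ fires on $\mu$ with mode $(\lambda,\rho)$ iff $\lambda\sqsubseteq\mu$, $\Pi^1(\lambda)={\tt pre}_{\hat N}(\hat\tau)$, $\Pi^1(\rho)={\tt post}_{\hat N}(\hat\tau)$,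 and for all $N$: $\Pi^2_N(\lambda)\ge{\tt pre}_N(\theta(N))$, $\Pi^2_N(\rho)=\Pi^2_N(\lambda)-{\tt pre}_N(\theta(N))+{\tt post}_N(\theta(N))$; result $\mu-\lambda+\rho$. $\mu\le_f\mu'$ iff $\mu'$ arises from $\mu$ by adding tokens inside existing nested tokens and/or adding nested tokens. An event is system autonomous if $\theta(N)=\emptyset$ for all $N$. $\tau$ is $\le_f$-coverable from $\iota$ if some configuration reachable from $\iota$ by event firings is $\ge_f\tau$. A $(\le_f,\omega)$-run is a finite sequence of configurations in which each consecutive pair is a firing step $C_i\to^eC_{i+1}$ or a lossy step $C_{i+1}\le_f C_i$; $\tau$ is $(\le_f,\omega)$-coverable from $\iota$ if such a run leads from $\iota$ to some configuration $\ge_f\tau$. $t\in\hat T$ destroys type $N$ if $\hat F(p,t)\ne0$ for some $p$ with $d(p)=N$ and $\hat F(t,q)=0$ for all $q$ with $d(q)=N$; $\mathit{destroy}(t)$ is the set of such $N$. Standing assumptions on $\mathfrak E$: every $t\in\hat T$ occurs in exactly one event of $\Theta$, and if $\mathit{destroy}(t)\ne\emptyset$ that event is system autonomous. Conservative closure: $\mathfrak E^{cons}=(\hat N^{cons},\mathcal N,d^{cons},\Theta)$, $\hat N^{cons}=(\hat P\cup\{\mathit{trash}_N:N\in\mathcal N\},\hat T,\hat F^{cons})$ with new places $\mathit{trash}_N$, $\hat F^{cons}(p,t)=\hat F(p,t)$ (zero on trash places), $\hat F^{cons}(t,p)=\hat F(t,p)$ for $p\in\hat P$, $\hat F^{cons}(t,\mathit{trash}_N)=1$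 iff $N\in\mathit{destroy}(t)$ (else $0$), $d^{cons}$ extends $d$ by $d^{cons}(\mathit{trash}_N)=N$. Configurations of $\mathfrak E$ are configurations of $\mathfrak E^{cons}$. -}

module Defs where

open import Data.Nat using (ℕ; zero; suc; _+_; _*_; _∸_; _≤_)
open import Data.Nat.Properties using () renaming (_≟_ to _≟ℕ_)
open import Data.Fin using (Fin; zero; suc)
open import Data.Fin.Properties using (any?; all?) renaming (_≟_ to _≟F_)
open import Data.Bool using (if_then_else_)
open import Data.Sum using (_⊎_; inj₁; inj₂)
open import Data.Sum.Properties using (≡-dec)
open import Data.Product using (Σ; ∃; _×_; _,_; proj₁; proj₂)
open import Data.List using (List; []; _∷_; _++_)
open import Data.List.Relation.Binary.Pointwise using (Pointwise)
open import Data.List.Relation.Binary.Permutation.Propositional using (_↭_)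
open import Relation.Binary.PropositionalEquality using (_≡_; _≢_; refl)
open import Relation.Binary.Definitions using (DecidableEquality)
open import Relation.Binary.Construct.Closure.ReflexiveTransitive using (Star)
open import Relation.Nullary using (Dec; yes; no; ¬_; does)
open import Relation.Nullary.Decidable using (_×-dec_; _→-dec_; ¬?)

ΣFin : (n : ℕ) → (Fin n → ℕ) → ℕ
ΣFin zero    f = 0
ΣFin (suc n) f = f zero + ΣFin n (λ i → f (suc i))

-- Object Petri nets: places Fin nP, transitions Fin nT,
-- pre t p = F(p,t), post t p = F(t,p).
record PN : Set where
  field
    nP   : ℕ
    nT   : ℕ
    pre  : Fin nT → Fin nP → ℕ
    post : Fin nT → Fin nP → ℕ
open PN public

Marking : PN → Set
Marking N = Fin (nP N) → ℕ

TMultiset : PN → Set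
TMultiset N = Fin (nT N) → ℕ

preM : (N : PN) → TMultiset N → Marking N
preM N θ q = ΣFin (nT N) (λ t → θ t * pre N t q)

postM : (N : PN) → TMultiset N → Marking N
postM N θ q = ΣFin (nT N) (λ t → θ t * post N t q)

record Event (sT k : ℕ) (obj : Fin k → PN) : Set where
  field
    hat : Fin sT
    θ   : (N : Fin k) → TMultiset (obj N)
open Event public

-- The system places form an arbitrary type with decidable equality so
-- that both an EOS (places Fin sP) and its conservative closure
-- (places Fin sP ⊎ Fin k, the inj₂ N being trash_N) are instances.
record System : Set₁ where
  field
    SP    : Set
    _≟P_  : DecidableEquality SP
    sT    : ℕ
    spre  : Fin sT → SP → ℕ
    spost : Fin sT → SP → ℕ
    k     : ℕ
    obj   : Fin k → PN
    d     : SP → Fin k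
    nE    : ℕ
    ev    : Fin nE → Event sT k obj
open System public

-- nested tokens and configurations (finite multisets as lists)
Token : System → Set
Token S = Σ (SP S) (λ p → Marking (obj S (d S p)))

Config : System → Set
Config S = List (Token S)

module _ (S : System) where

  countP : SP S → Config S → ℕ
  countP p [] = 0
  countP p ((q , _) ∷ μ) with _≟P_ S p q
  ... | yes _ = suc (countP p μ)
  ... | no  _ = countP p μ

  markAt : (N M : Fin (k S)) → Marking (obj S M) → Marking (obj S N)
  markAt N M m with M ≟F N
  ... | yes refl = m
  ... | no  _    = λ _ → 0

  Π² : (N : Fin (k S)) → Config S → Marking (obj S N)
  Π² N [] q = 0
  Π² N ((p , m) ∷ μ) q = markAt N (d S p) m q + Π² N μ q

  -- event e fires on μ with mode (λ, ρ) yielding μ'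
  -- (λ ⊑ μ is witnessed by μ ↭ λ ++ rest, and μ - λ + ρ is rest ++ ρ)
  FiresWith : Event (sT S) (k S) (obj S) → Config S → Config S → Config S → Config S → Set
  FiresWith e μ lam ρ μ' =
    Σ (Config S) λ rest →
      (μ ↭ (lam ++ rest))
    × (∀ p → countP p lam ≡ spre S (hat e) p)
    × (∀ p → countP p ρ ≡ spost S (hat e) p)
    × (∀ N q → preM (obj S N) (θ e N) q ≤ Π² N lam q)
    × (∀ N q → Π² N ρ q ≡ (Π² N lam q ∸ preM (obj S N) (θ e N) q) + postM (obj S N) (θ e N) q)
    × (μ' ↭ (rest ++ ρ))

  Step : Config S → Config S → Set
  Step μ μ' = Σ (Fin (nE S)) λ i → Σ (Config S) λ lam → Σ (Config S) λ ρ →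
                FiresWith (ev S i) μ lam ρ μ'

  data TokLe : Token S → Token S → Set where
    tokLe : ∀ p {m m' : Marking (obj S (d S p))} →
            (∀ q → m q ≤ m' q) → TokLe (p , m) (p , m')

  _≤f_ : Config S → Config S → Set
  μ ≤f μ' = Σ (Config S) λ ν → Σ (Config S) λ extra →
              Pointwise TokLe μ ν × (μ' ↭ (ν ++ extra))

  Coverable : Config S → Config S → Set
  Coverable ι τ = Σ (Config S) λ C → Star Step ι C × (τ ≤f C)

  LossyStep : Config S → Config S → Set
  LossyStep C C' = Step C C' ⊎ (C' ≤f C)

  LossyCoverable : Config S → Config S → Set
  LossyCoverable ι τ = Σ (Config S) λ C → Star LossyStep ι C × (τ ≤f C)

record EOS : Set where
  field
    sP    : ℕ
    sT    : ℕ
    F-pre  : Fin sT → Fin sP → ℕ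
    F-post : Fin sT → Fin sP → ℕ
    idle  : Fin sP → Fin sT
    k     : ℕ
    obj   : Fin k → PN
    black : Fin k
    d     : Fin sP → Fin k
    nE    : ℕ
    ev    : Fin nE → Event sT k obj

module _ (E : EOS) where
  open EOS E renaming (sT to sTE; k to kE; obj to objE; d to dE; nE to nEE; ev to evE)

  unit : Fin sP → Fin sP → ℕ
  unit p q = if does (p ≟F q) then 1 else 0

  record IsEOS : Set where
    field
      black-empty : nP (objE black) ≡ 0 × nT (objE black) ≡ 0
      idle-pre    : ∀ p q → F-pre  (idle p) q ≡ unit p q
      idle-post   : ∀ p q → F-post (idle p) q ≡ unit p q
      idle-event  : ∀ i p → hat (evE i) ≡ idle p → ¬ (∀ x → θ (evE i) (dE p) x ≡ 0)

  Destroys : Fin sTE → Fin kE → Set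
  Destroys t N = (∃ λ p → dE p ≡ N × F-pre t p ≢ 0) × (∀ q → dE q ≡ N → F-post t q ≡ 0)

  destroys? : ∀ t N → Dec (Destroys t N)
  destroys? t N = any? (λ p → (dE p ≟F N) ×-dec ¬? (F-pre t p ≟ℕ 0))
                  ×-dec all? (λ q → (dE q ≟F N) →-dec (F-post t q ≟ℕ 0))

  SystemAutonomous : Event sTE kE objE → Set
  SystemAutonomous e = ∀ N x → θ e N x ≡ 0

  record Standing : Set where
    field
      exactly-one : ∀ t → Σ (Fin nEE) λ i → hat (evE i) ≡ t × (∀ j → hat (evE j) ≡ t → j ≡ i)
      destroy-autonomous : ∀ i → (∃ λ N → Destroys (hat (evE i)) N) → SystemAutonomous (evE i)

  sys : System
  sys = record
    { SP = Fin sP ; _≟P_ = _≟F_ ; sT = sTE ; spre = F-pre ; spost = F-post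
    ; k = kE ; obj = objE ; d = dE ; nE = nEE ; ev = evE }

  -- conservative closure: places Fin sP ⊎ Fin kE, inj₂ N = trash_N
  consPre : Fin sTE → Fin sP ⊎ Fin kE → ℕ
  consPre t (inj₁ p) = F-pre t p
  consPre t (inj₂ N) = 0

  consPost : Fin sTE → Fin sP ⊎ Fin kE → ℕ
  consPost t (inj₁ p) = F-post t p
  consPost t (inj₂ N) = if does (destroys? t N) then 1 else 0

  consD : Fin sP ⊎ Fin kE → Fin kE
  consD (inj₁ p) = dE p
  consD (inj₂ N) = N

  cons : System
  cons = record
    { SP = Fin sP ⊎ Fin kE ; _≟P_ = ≡-dec _≟F_ _≟F_ ; sT = sTE
    ; spre = consPre ; spost = consPost
    ; k = kE ; obj = objE ; d = consD ; nE = nEE ; ev = evE }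

  embTok : Token sys → Token cons
  embTok (p , m) = (inj₁ p , m)

  emb : Config sys → Config cons
  emb [] = []
  emb (x ∷ μ) = embTok x ∷ emb μ

{-# OPTIONS --safe #-}
-- Forget the trash places. A step of E^cons whose transition t destroys the types D
-- becomes, in E, a lossy step emptying the consumed nested tokens of types in D,
-- followed by the same event. This is a legal firing in E: t's event is system
-- autonomous and t produces no nested token of a type in D, so for these types the
-- event must consume exactly empty markings.
module Submission where

open import Defs
open import Data.Nat using (ℕ; zero; suc; _+_; _*_; _∸_; _≤_; z≤n)
open import Data.Nat.Properties using (≤-refl)
open import Data.Fin using (Fin)
open import Data.Fin.Properties using () renaming (_≟_ to _≟F_)
open import Data.Bool using (true; false; if_then_else_)
open import Data.Maybe using (Maybe; just; nothing)
open import Data.Sum using (inj₁; inj₂)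
open import Data.Product using (_,_; proj₂)
open import Data.List using ([]; _∷_; _++_; map; mapMaybe)
open import Data.List.Properties using (mapMaybe-++; ++-identityʳ)
open import Data.List.Relation.Binary.Pointwise using (Pointwise; []; _∷_; ++⁺ʳ)
open import Data.List.Relation.Binary.Permutation.Propositional
  using (_↭_; ↭-refl; ↭-trans; ↭-reflexive)
open import Data.List.Relation.Binary.Permutation.Propositional.Properties using (mapMaybe-↭)
open import Relation.Binary.PropositionalEquality
  using (_≡_; refl; sym; trans; cong; cong₂; subst; module ≡-Reasoning)
open import Relation.Binary.Construct.Closure.ReflexiveTransitive using (Star; ε; _◅_; kleisliStar)
open import Relation.Nullary using (¬_; yes; no; does; contradiction)
open import Relation.Nullary.Decidable using (dec-true; dec-false)
open import Relation.Unary using (Pred; Decidable)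

ΣFin-zero : ∀ n {f : Fin n → ℕ} → (∀ i → f i ≡ 0) → ΣFin n f ≡ 0
ΣFin-zero zero    f≡0 = refl
ΣFin-zero (suc n) f≡0 rewrite f≡0 Fin.zero = ΣFin-zero n (λ i → f≡0 (Fin.suc i))

module _ (N : PN) {θ : TMultiset N} (θ≡0 : ∀ t → θ t ≡ 0) where

  preM-zero : ∀ q → preM N θ q ≡ 0
  preM-zero q = ΣFin-zero (nT N) (λ t → cong (_* pre N t q) (θ≡0 t))

  postM-zero : ∀ q → postM N θ q ≡ 0
  postM-zero q = ΣFin-zero (nT N) (λ t → cong (_* post N t q) (θ≡0 t))

module _ (S : System) where

  TokLe-refl : ∀ {x} → TokLe S x x
  TokLe-refl {p , _} = tokLe p (λ _ → ≤-refl)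

  pointwise⇒≤f : ∀ {L L' A} → Pointwise (TokLe S) L L' → A ↭ L' → _≤f_ S L A
  pointwise⇒≤f {L' = L'} L≤L' A↭L' =
    L' , [] , L≤L' , ↭-trans A↭L' (↭-reflexive (sym (++-identityʳ L')))

  countP-head : ∀ p m L → countP S p ((p , m) ∷ L) ≡ suc (countP S p L)
  countP-head p m L with _≟P_ S p p
  ... | yes _  = refl
  ... | no p≢p = contradiction refl p≢p

  Π²-absent : ∀ N L → (∀ p → d S p ≡ N → countP S p L ≡ 0) → ∀ q → Π² S N L q ≡ 0
  Π²-absent N [] _ q = refl
  Π²-absent N ((p , m) ∷ L) absent q with d S p ≟F N
  ... | yes dp≡N = contradiction (trans (sym (countP-head p m L)) (absent p dp≡N)) λ ()
  ... | no  _    = Π²-absent N L absent′ q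
    where
    absent′ : ∀ p′ → d S p′ ≡ N → countP S p′ L ≡ 0
    absent′ p′ dp′≡N with _≟P_ S p′ p | absent p′ dp′≡N
    ... | yes _ | ()
    ... | no  _ | eq = eq

module _ (S : System) {ℓ} {P : Pred (Fin (k S)) ℓ} (P? : Decidable P) where

  clearTok : Token S → Token S
  clearTok (p , m) = p , (if does (P? (d S p)) then (λ _ → 0) else m)

  clear : Config S → Config S
  clear = map clearTok

  clear-pointwise : ∀ L → Pointwise (TokLe S) (clear L) L
  clear-pointwise [] = []
  clear-pointwise ((p , m) ∷ L) = tokLe p cleared≤m ∷ clear-pointwise L
    where
    cleared≤m : ∀ q → proj₂ (clearTok (p , m)) q ≤ m q
    cleared≤m q with does (P? (d S p))
    ... | true  = z≤n
    ... | false = ≤-refl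

  countP-clear : ∀ p L → countP S p (clear L) ≡ countP S p L
  countP-clear p [] = refl
  countP-clear p ((q , _) ∷ L) with _≟P_ S p q
  ... | yes _ = cong suc (countP-clear p L)
  ... | no  _ = countP-clear p L

  Π²-clear-cleared : ∀ {N} → P N → ∀ L q → Π² S N (clear L) q ≡ 0
  Π²-clear-cleared PN [] q = refl
  Π²-clear-cleared {N} PN ((p , m) ∷ L) q with d S p ≟F N
  ... | yes refl rewrite dec-true (P? (d S p)) PN = Π²-clear-cleared PN L q
  ... | no  _    = Π²-clear-cleared PN L q

  Π²-clear-kept : ∀ {N} → ¬ P N → ∀ L q → Π² S N (clear L) q ≡ Π² S N L q
  Π²-clear-kept ¬PN [] q = refl
  Π²-clear-kept {N} ¬PN ((p , m) ∷ L) q with d S p ≟F N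
  ... | yes refl rewrite dec-false (P? (d S p)) ¬PN = cong (m q +_) (Π²-clear-kept ¬PN L q)
  ... | no  _    = Π²-clear-kept ¬PN L q

module Forget (E : EOS) where

  private
    S = sys E
    C = cons E

  forgetTrash : Token C → Maybe (Token S)
  forgetTrash (inj₁ p , m) = just (p , m)
  forgetTrash (inj₂ _ , _) = nothing

  strip : Config C → Config S
  strip = mapMaybe forgetTrash

  strip-emb : ∀ L → strip (emb E L) ≡ L
  strip-emb []      = refl
  strip-emb (x ∷ L) = cong (x ∷_) (strip-emb L)

  strip-pointwise : ∀ {L ν} → Pointwise (TokLe C) (emb E L) ν → Pointwise (TokLe S) L (strip ν)
  strip-pointwise {[]}    []                           = []
  strip-pointwise {_ ∷ _} (tokLe (inj₁ p) m≤m′ ∷ L≤ν) = tokLe p m≤m′ ∷ strip-pointwise L≤ν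

  strip-↭ : ∀ {A B} → A ↭ B → strip A ↭ strip B
  strip-↭ = mapMaybe-↭ forgetTrash

  strip-↭-++ : ∀ {A} L L′ → A ↭ L ++ L′ → strip A ↭ strip L ++ strip L′
  strip-↭-++ L L′ A↭ = ↭-trans (strip-↭ A↭) (↭-reflexive (mapMaybe-++ forgetTrash L L′))

  strip-≤f : ∀ {τ A} → _≤f_ C (emb E τ) A → _≤f_ S τ (strip A)
  strip-≤f (ν , extra , τ≤ν , A↭) =
    strip ν , strip extra , strip-pointwise τ≤ν , strip-↭-++ ν extra A↭

  countP-strip : ∀ p L → countP S p (strip L) ≡ countP C (inj₁ p) L
  countP-strip p [] = refl
  countP-strip p ((inj₁ q , _) ∷ L) with p ≟F q
  ... | yes refl = cong suc (countP-strip p L)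
  ... | no  _    = countP-strip p L
  countP-strip p ((inj₂ _ , _) ∷ L) = countP-strip p L

  -- Both sides compute the same marking, but markAt only reduces once M ≟F N is decided.
  markAt-sys≡cons : ∀ N M (m : Marking (obj S M)) q → markAt S N M m q ≡ markAt C N M m q
  markAt-sys≡cons N M m q with M ≟F N
  ... | yes refl = refl
  ... | no  _    = refl

  Π²-strip : ∀ N L → countP C (inj₂ N) L ≡ 0 → ∀ q → Π² S N (strip L) q ≡ Π² C N L q
  Π²-strip N [] _ q = refl
  Π²-strip N ((inj₁ p , m) ∷ L) noTrash q =
    cong₂ _+_ (markAt-sys≡cons N (d S p) m q) (Π²-strip N L noTrash q)
  Π²-strip N ((inj₂ N′ , m) ∷ L) noTrash q with N ≟F N′ | N′ ≟F N
  ... | yes _    | _        = contradiction noTrash λ ()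
  ... | no  _    | no  _    = Π²-strip N L noTrash q
  ... | no  N≢N′ | yes N′≡N = contradiction (sym N′≡N) N≢N′

module Simulation (E : EOS) (standing : Standing E) where
  open Forget E
  open ≡-Reasoning

  private
    S = sys E
    C = cons E

  module Mode (i : Fin (nE S)) {lam ρ : Config C}
           (lam-count : ∀ p → countP C p lam ≡ spre C (hat (ev C i)) p)
           (ρ-count   : ∀ p → countP C p ρ ≡ spost C (hat (ev C i)) p) where

    private
      e = ev S i
      t = hat e
      preθ  = λ N → preM (obj S N) (θ e N)
      postθ = λ N → postM (obj S N) (θ e N)
      destroyed? = destroys? E t

    lam′ : Config S
    lam′ = clear S destroyed? (strip lam)

    lam′-pointwise : Pointwise (TokLe S) lam′ (strip lam)
    lam′-pointwise = clear-pointwise S destroyed? (strip lam)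

    lam′-count : ∀ p → countP S p lam′ ≡ spre S t p
    lam′-count p = begin
      countP S p lam′               ≡⟨ countP-clear S destroyed? p (strip lam) ⟩
      countP S p (strip lam)        ≡⟨ countP-strip p lam ⟩
      countP C (inj₁ p) lam         ≡⟨ lam-count (inj₁ p) ⟩
      spre S t p                    ∎

    ρ′-count : ∀ p → countP S p (strip ρ) ≡ spost S t p
    ρ′-count p = trans (countP-strip p ρ) (ρ-count (inj₁ p))

    Π²-lam′-kept : ∀ {N} → ¬ Destroys E t N → ∀ q → Π² S N lam′ q ≡ Π² C N lam q
    Π²-lam′-kept ¬D q = trans (Π²-clear-kept S destroyed? ¬D (strip lam) q)
                              (Π²-strip _ lam (lam-count (inj₂ _)) q)

    Π²-ρ′-kept : ∀ {N} → ¬ Destroys E t N → ∀ q → Π² S N (strip ρ) q ≡ Π² C N ρ q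
    Π²-ρ′-kept {N} ¬D = Π²-strip N ρ noTrash
      where
      noTrash : countP C (inj₂ N) ρ ≡ 0
      noTrash = trans (ρ-count (inj₂ N)) (cong (if_then 1 else 0) (dec-false (destroyed? N) ¬D))

    Π²-ρ′-destroyed : ∀ {N} → Destroys E t N → ∀ q → Π² S N (strip ρ) q ≡ 0
    Π²-ρ′-destroyed {N} (_ , noPost) =
      Π²-absent S N (strip ρ) λ p dp≡N → trans (ρ′-count p) (noPost p dp≡N)

    θ-destroyed : ∀ {N} → Destroys E t N → ∀ M x → θ e M x ≡ 0
    θ-destroyed {N} D = Standing.destroy-autonomous standing i (N , D)

    lam′-enabled : (∀ N q → preθ N q ≤ Π² C N lam q) → ∀ N q → preθ N q ≤ Π² S N lam′ q
    lam′-enabled enabled N q with destroyed? N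
    ... | yes D  = subst (_≤ Π² S N lam′ q) (sym (preM-zero (obj S N) (θ-destroyed D N) q)) z≤n
    ... | no  ¬D = subst (preθ N q ≤_) (sym (Π²-lam′-kept ¬D q)) (enabled N q)

    ρ′-effect : (∀ N q → Π² C N ρ q ≡ (Π² C N lam q ∸ preθ N q) + postθ N q) →
                ∀ N q → Π² S N (strip ρ) q ≡ (Π² S N lam′ q ∸ preθ N q) + postθ N q
    ρ′-effect effect N q with destroyed? N
    ... | yes D
      rewrite Π²-ρ′-destroyed D q | Π²-clear-cleared S destroyed? D (strip lam) q
            | preM-zero (obj S N) (θ-destroyed D N) q | postM-zero (obj S N) (θ-destroyed D N) q
      = refl
    ... | no ¬D = begin
      Π² S N (strip ρ) q                          ≡⟨ Π²-ρ′-kept ¬D q ⟩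
      Π² C N ρ q                                  ≡⟨ effect N q ⟩
      (Π² C N lam q ∸ preθ N q) + postθ N q       ≡⟨ cong (λ n → (n ∸ preθ N q) + postθ N q)
                                                         (sym (Π²-lam′-kept ¬D q)) ⟩
      (Π² S N lam′ q ∸ preθ N q) + postθ N q      ∎

  step-simulation : ∀ {A B} → Step C A B → Star (LossyStep S) (strip A) (strip B)
  step-simulation {A} {B} (i , lam , ρ , rest , A↭ , lam-count , ρ-count , enabled , effect , B↭) =
    inj₂ clearing ◅ inj₁ firing ◅ ε
    where
    open Mode i {lam} {ρ} lam-count ρ-count
    clearing : _≤f_ S (lam′ ++ strip rest) (strip A)
    clearing = pointwise⇒≤f S (++⁺ʳ (TokLe-refl S) (strip rest) lam′-pointwise)
                                (strip-↭-++ lam rest A↭)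
    firing : Step S (lam′ ++ strip rest) (strip B)
    firing = i , lam′ , strip ρ , strip rest , ↭-refl
           , lam′-count , ρ′-count , lam′-enabled enabled , ρ′-effect effect , strip-↭-++ rest ρ B↭

theorem5 : (E : EOS) → IsEOS E → Standing E →
    (ι τ : Config (sys E)) →
    Coverable (cons E) (emb E ι) (emb E τ) →
    LossyCoverable (sys E) ι τ
theorem5 E _ standing ι τ (A , run , τ≤A) =
  strip A , subst (λ X → Star (LossyStep (sys E)) X (strip A)) (strip-emb ι) lossyRun
          , strip-≤f τ≤A
  where
  open Forget E
  open Simulation E standing
  lossyRun : Star (LossyStep (sys E)) (strip (emb E ι)) (strip A)
  lossyRun = kleisliStar strip step-simulation run
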